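{- Let $k,\ell\in\mathbb{N}_{>1}$ with $k<\ell$ be multiplicatively independent, and let $(x,y)\in k^{\mathbb{N}}\times\ell^{\mathbb{N}}$. Then the following are equivalent: (1) $(x,y)\in S$; (2) there is $z\in k^{\mathbb{N}}$ such that $x<z$ and $y\in[z+x,\,z+kx)$; (3) $1$ is the most significant digit in the base-$k$ representation of $y$, and $x$ is the second largest power of $k$ that appears with a non-zero digit in the base-$k$ representation of $y$.
   Context: $k^{\mathbb{N}}=\{k^i:i\in\mathbb{N}\}$, $\ell^{\mathbb{N}}=\{\ell^i:i\in\mathbb{N}\}$. For a positive integer $y$, $\lambda(y)=\max\{k^n: n\in\mathbb{N},\ k^n\leq y\}$ (the largest power of $k$ that is at most $y$). Define $S=\{(x,y)\in k^{\mathbb{N}}\times\ell^{\mathbb{N}} : y-\lambda(y)>0,\ \lambda(y-\lambda(y))=x,\ x<\lambda(y)\}$. -}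

module Defs where

open import Data.Nat using (ℕ; zero; suc; _+_; _*_; _∸_; _^_; _≤_; _<_; NonZero)
open import Data.Nat.Properties using (m^n≢0)
open import Data.Nat.DivMod using (_/_; _%_)
open import Data.Product using (Σ; ∃; _×_; _,_)
open import Relation.Binary.PropositionalEquality using (_≡_; _≢_)
open import Relation.Nullary using (¬_)

IsPowOf : ℕ → ℕ → Set
IsPowOf k x = ∃ λ i → x ≡ k ^ i

MultIndep : ℕ → ℕ → Set
MultIndep k ℓ = ∀ m n → k ^ m ≡ ℓ ^ n → (m ≡ 0) × (n ≡ 0)

IsLambda : ℕ → ℕ → ℕ → Set
IsLambda k y p = IsPowOf k p × p ≤ y × (∀ n → k ^ n ≤ y → k ^ n ≤ p)

InS : ℕ → ℕ → ℕ → ℕ → Set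
InS k ℓ x y = IsPowOf k x × IsPowOf ℓ y ×
  (∃ λ p → IsLambda k y p × 0 < y ∸ p × IsLambda k (y ∸ p) x × x < p)

-- i-th base-k digit of y (position i, weight k^i): ⌊y / k^i⌋ mod k   (only meaningful for k ≥ 2)
digit : ℕ → ℕ → ℕ → ℕ
digit zero i y = 0
digit (suc k) i y = (y / (suc k ^ i)) {{m^n≢0 (suc k) i}} % suc k

-- Write λ(y) = k^a. For x = k^b, each of (1), (2), (3) says exactly that y = k^a + r with b < a and
-- k^b ≤ r < k^(b+1), i.e. r has leading power k^b: for (1) by the magnitude characterisation of λ,
-- for (2) with z = k^a, and for (3) because the base-k digits of k^a + r are those of r below
-- position a and a single 1 at position a; conversely, zero digits strictly between positions m and n
-- force ⌊y / k^(m+1)⌋ = k^(n-m-1), which pins y down to k^n + d k^m + (y mod k^m) with 0 < d < k.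
module Submission where

open import Defs
open import Data.Nat
open import Data.Nat.Properties
open import Data.Nat.DivMod
open import Data.Nat.Divisibility using (divides)
open import Data.Nat.Solver using (module +-*-Solver)
open import Data.Product using (∃; _×_; _,_; proj₁; proj₂)
open import Function.Base using (_∘_)
open import Function.Bundles using (_⇔_; mk⇔)
open import Relation.Binary.PropositionalEquality

digit≡ : ∀ k .{{_ : NonZero k}} j y → digit k j y ≡ (y / k ^ j) {{m^n≢0 k j}} % k
digit≡ (suc k) j y = refl

module Base (k : ℕ) (1<k : 1 < k) where

  instance
    k≢0 : NonZero k
    k≢0 = >-nonZero (<-trans z<s 1<k)

  -- Instance search cannot solve NonZero (k ^ j) for a variable j, so such instances are
  -- fixed here and supplied locally in the proofs below.
  _/k^_ : ℕ → ℕ → ℕ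
  y /k^ j = (y / k ^ j) {{m^n≢0 k j}}

  ^-cancelʳ-< : ∀ {a b} → k ^ a < k ^ b → a < b
  ^-cancelʳ-< lt = ≰⇒> (λ b≤a → <⇒≱ lt (^-monoʳ-≤ k b≤a))

  k^a+k^a≤k^[1+a] : ∀ a → k ^ a + k ^ a ≤ k ^ suc a
  k^a+k^a≤k^[1+a] a = begin
    k ^ a + k ^ a  ≡⟨ cong (k ^ a +_) (sym (+-identityʳ (k ^ a))) ⟩
    2 * k ^ a      ≤⟨ *-monoˡ-≤ (k ^ a) 1<k ⟩
    k * k ^ a      ∎
    where open ≤-Reasoning

  Magnitude : ℕ → ℕ → Set
  Magnitude n y = k ^ n ≤ y × y < k ^ suc n

  magnitude⇒isLambda : ∀ {n y} → Magnitude n y → IsLambda k y (k ^ n)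
  magnitude⇒isLambda {n} (lo , hi) =
    (n , refl) , lo , λ i k^i≤y → ^-monoʳ-≤ k {i} {n} (m<1+n⇒m≤n (^-cancelʳ-< {i} (≤-<-trans k^i≤y hi)))

  isLambda⇒magnitude : ∀ {y p} → IsLambda k y p → ∃ λ n → p ≡ k ^ n × Magnitude n y
  isLambda⇒magnitude ((n , refl) , lo , maximal) =
    n , refl , lo , ≰⇒> (λ k^[1+n]≤y → <⇒≱ (^-monoʳ-< k 1<k (n<1+n n)) (maximal (suc n) k^[1+n]≤y))

  magnitude-+ : ∀ {a b r} → b < a → Magnitude b r → Magnitude a (k ^ a + r)
  magnitude-+ {a} {b} {r} b<a (_ , r<k^[1+b]) = m≤m+n (k ^ a) r , (begin-strict
    k ^ a + r          <⟨ +-monoʳ-< (k ^ a) r<k^[1+b] ⟩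
    k ^ a + k ^ suc b  ≤⟨ +-monoʳ-≤ (k ^ a) (^-monoʳ-≤ k b<a) ⟩
    k ^ a + k ^ a      ≤⟨ k^a+k^a≤k^[1+a] a ⟩
    k ^ suc a          ∎)
    where open ≤-Reasoning

  magnitude-digitBlock : ∀ {m d e} → 0 < d → d < k → e < k ^ m → Magnitude m (d * k ^ m + e)
  magnitude-digitBlock {m} {d} {e} 0<d d<k e<k^m = lo , hi
    where
      open ≤-Reasoning
      lo : k ^ m ≤ d * k ^ m + e
      lo = begin
        k ^ m          ≡⟨ sym (*-identityˡ (k ^ m)) ⟩
        1 * k ^ m      ≤⟨ *-monoˡ-≤ (k ^ m) 0<d ⟩
        d * k ^ m      ≤⟨ m≤m+n (d * k ^ m) e ⟩
        d * k ^ m + e  ∎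
      hi : d * k ^ m + e < k ^ suc m
      hi = begin-strict
        d * k ^ m + e      <⟨ +-monoʳ-< (d * k ^ m) e<k^m ⟩
        d * k ^ m + k ^ m  ≡⟨ +-comm (d * k ^ m) (k ^ m) ⟩
        suc d * k ^ m      ≤⟨ *-monoˡ-≤ (k ^ m) d<k ⟩
        k ^ suc m          ∎

  k^a≡k^[a∸j]*k^j : ∀ {a j} → j ≤ a → k ^ a ≡ k ^ (a ∸ j) * k ^ j
  k^a≡k^[a∸j]*k^j {a} {j} j≤a = trans (cong (k ^_) (sym (m∸n+n≡m j≤a))) (^-distribˡ-+-* k (a ∸ j) j)

  [k^a+r]/k^j≡k^[a∸j]+r/k^j : ∀ {a j} r → j ≤ a → (k ^ a + r) /k^ j ≡ k ^ (a ∸ j) + r /k^ j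
  [k^a+r]/k^j≡k^[a∸j]+r/k^j {a} {j} r j≤a = begin
    (k ^ a + r) / k ^ j                     ≡⟨ +-distrib-/-∣ˡ r (divides (k ^ (a ∸ j)) (k^a≡k^[a∸j]*k^j j≤a)) ⟩
    k ^ a / k ^ j + r / k ^ j               ≡⟨ cong (λ t → t / k ^ j + r / k ^ j) (k^a≡k^[a∸j]*k^j j≤a) ⟩
    k ^ (a ∸ j) * k ^ j / k ^ j + r / k ^ j ≡⟨ cong (_+ r / k ^ j) (m*n/n≡m (k ^ (a ∸ j)) (k ^ j)) ⟩
    k ^ (a ∸ j) + r / k ^ j                 ∎
    where
      open ≡-Reasoning
      instance _ = m^n≢0 k j

  [k^e+c]%k≡c%k : ∀ {e} c → 0 < e → (k ^ e + c) % k ≡ c % k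
  [k^e+c]%k≡c%k {suc e} c _ = %-remove-+ˡ c (divides (k ^ e) (*-comm k (k ^ e)))

  digit-k^a+r : ∀ {a j} r → j < a → digit k j (k ^ a + r) ≡ digit k j r
  digit-k^a+r {a} {j} r j<a = begin
    digit k j (k ^ a + r)         ≡⟨ digit≡ k j (k ^ a + r) ⟩
    (k ^ a + r) /k^ j % k         ≡⟨ cong (_% k) ([k^a+r]/k^j≡k^[a∸j]+r/k^j r (<⇒≤ j<a)) ⟩
    (k ^ (a ∸ j) + r /k^ j) % k   ≡⟨ [k^e+c]%k≡c%k (r /k^ j) (m<n⇒0<n∸m j<a) ⟩
    r /k^ j % k                   ≡⟨ sym (digit≡ k j r) ⟩
    digit k j r                   ∎
    where open ≡-Reasoning

  digit-k^a+r-top : ∀ {a r} → r < k ^ a → digit k a (k ^ a + r) ≡ 1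
  digit-k^a+r-top {a} {r} r<k^a = begin
    digit k a (k ^ a + r)          ≡⟨ digit≡ k a (k ^ a + r) ⟩
    (k ^ a + r) /k^ a % k          ≡⟨ cong (_% k) ([k^a+r]/k^j≡k^[a∸j]+r/k^j r (≤-refl {a})) ⟩
    (k ^ (a ∸ a) + r /k^ a) % k    ≡⟨ cong₂ (λ u v → (k ^ u + v) % k) (n∸n≡0 a) (m<n⇒m/n≡0 r<k^a) ⟩
    1 % k                          ≡⟨ m<n⇒m%n≡m 1<k ⟩
    1                              ∎
    where
      open ≡-Reasoning
      instance _ = m^n≢0 k a

  digit-small : ∀ {j r} → r < k ^ j → digit k j r ≡ 0
  digit-small {j} {r} r<k^j =
    trans (digit≡ k j r) (trans (cong (_% k) (m<n⇒m/n≡0 r<k^j)) (m<n⇒m%n≡m (<-trans z<s 1<k)))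
    where instance _ = m^n≢0 k j

  digit-top : ∀ {n y} → y < k ^ suc n → digit k n y ≡ y /k^ n
  digit-top {n} {y} y<k^[1+n] = trans (digit≡ k n y) (m<n⇒m%n≡m (m<n*o⇒m/o<n y<k^[1+n]))
    where instance _ = m^n≢0 k n

  magnitude⇒digit≢0 : ∀ {n y} → Magnitude n y → digit k n y ≢ 0
  magnitude⇒digit≢0 {n} (lo , hi) eq = <⇒≢ (m≥n⇒m/n>0 lo) (sym (trans (sym (digit-top hi)) eq))
    where instance _ = m^n≢0 k n

  /k^-digitStep : ∀ j y → y /k^ j ≡ y /k^ suc j * k + digit k j y
  /k^-digitStep j y = begin
    q                          ≡⟨ m≡m%n+[m/n]*n q k ⟩
    q % k + q / k * k          ≡⟨ +-comm (q % k) (q / k * k) ⟩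
    q / k * k + q % k          ≡⟨ cong₂ (λ u v → u * k + v) q/k≡y/k^[1+j] (sym (digit≡ k j y)) ⟩
    y /k^ suc j * k + digit k j y ∎
    where
      open ≡-Reasoning
      instance
        _ = m^n≢0 k j
        _ = m^n≢0 k (suc j)
        _ = m*n≢0 (k ^ j) k
      q = y /k^ j
      q/k≡y/k^[1+j] : q / k ≡ y /k^ suc j
      q/k≡y/k^[1+j] = trans (m/n/o≡m/[n*o] y (k ^ j) k) (/-congʳ (*-comm (k ^ j) k))

  /k^-zeroDigits : ∀ y j d → (∀ i → j ≤ i → i < j + d → digit k i y ≡ 0) →
                   y /k^ j ≡ y /k^ (j + d) * k ^ d
  /k^-zeroDigits y j zero _ = trans (cong (y /k^_) (sym (+-identityʳ j))) (sym (*-identityʳ _))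
  /k^-zeroDigits y j (suc d) zeros = begin
    y /k^ j                               ≡⟨ /k^-digitStep j y ⟩
    y /k^ suc j * k + digit k j y         ≡⟨ cong₂ (λ u v → u * k + v) IH (zeros j ≤-refl (m<m+n j z<s)) ⟩
    y /k^ (suc j + d) * k ^ d * k + 0     ≡⟨ cong (λ t → y /k^ t * k ^ d * k + 0) (sym (+-suc j d)) ⟩
    y /k^ (j + suc d) * k ^ d * k + 0     ≡⟨ solve 3 (λ q p k → q :* p :* k :+ con 0 := q :* (k :* p)) refl
                                               (y /k^ (j + suc d)) (k ^ d) k ⟩
    y /k^ (j + suc d) * k ^ suc d         ∎
    where
      open ≡-Reasoning
      open +-*-Solver
      IH : y /k^ suc j ≡ y /k^ (suc j + d) * k ^ d
      IH = /k^-zeroDigits y (suc j) d λ i 1+j≤i i<1+j+d →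
             zeros i (<⇒≤ 1+j≤i) (subst (i <_) (sym (+-suc j d)) i<1+j+d)

  digit<k : ∀ j y → digit k j y < k
  digit<k j y = subst (_< k) (sym (digit≡ k j y)) (m%n<n (y /k^ j) k)

  LeadingPowers : ℕ → ℕ → Set
  LeadingPowers x y = ∃ λ a → ∃ λ b → ∃ λ r → b < a × x ≡ k ^ b × y ≡ k ^ a + r × Magnitude b r

  inS⇒leadingPowers : ∀ {ℓ x y} → InS k ℓ x y → LeadingPowers x y
  inS⇒leadingPowers {y = y} (_ , _ , _ , isLambda-y , _ , isLambda-r , x<p)
    with isLambda⇒magnitude isLambda-y | isLambda⇒magnitude isLambda-r
  ... | a , refl , (k^a≤y , _) | b , refl , magnitude-r =
    a , b , y ∸ k ^ a , ^-cancelʳ-< x<p , refl , sym (m+[n∸m]≡n k^a≤y) , magnitude-r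

  leadingPowers⇒inS : ∀ {ℓ x y} → IsPowOf k x → IsPowOf ℓ y → LeadingPowers x y → InS k ℓ x y
  leadingPowers⇒inS px py (a , b , r , b<a , refl , refl , magnitude-r@(k^b≤r , _)) =
    px , py , k ^ a , magnitude⇒isLambda {a} (magnitude-+ b<a magnitude-r) ,
    subst (0 <_) (sym y∸k^a≡r) (<-≤-trans (m^n>0 k b) k^b≤r) ,
    subst (λ t → IsLambda k t (k ^ b)) (sym y∸k^a≡r) (magnitude⇒isLambda {b} magnitude-r) ,
    ^-monoʳ-< k 1<k b<a
    where
      y∸k^a≡r : k ^ a + r ∸ k ^ a ≡ r
      y∸k^a≡r = m+n∸m≡n (k ^ a) r

  Window : ℕ → ℕ → Set
  Window x y = ∃ λ z → IsPowOf k z × x < z × z + x ≤ y × y < z + k * x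

  leadingPowers⇒window : ∀ {x y} → LeadingPowers x y → Window x y
  leadingPowers⇒window (a , b , r , b<a , refl , refl , k^b≤r , r<k^[1+b]) =
    k ^ a , (a , refl) , ^-monoʳ-< k 1<k b<a , +-monoʳ-≤ (k ^ a) k^b≤r , +-monoʳ-< (k ^ a) r<k^[1+b]

  window⇒leadingPowers : ∀ {x y} → IsPowOf k x → Window x y → LeadingPowers x y
  window⇒leadingPowers (b , refl) (_ , (a , refl) , x<z , lo , hi)
    with m≤n⇒∃[o]m+o≡n (≤-trans (m≤m+n (k ^ a) (k ^ b)) lo)
  ... | r , refl =
    a , b , r , ^-cancelʳ-< x<z , refl , refl , +-cancelˡ-≤ (k ^ a) _ _ lo , +-cancelˡ-< (k ^ a) _ _ hi

  Digits : ℕ → ℕ → Set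
  Digits x y = ∃ λ n → k ^ n ≤ y × y < k ^ (suc n) × digit k n y ≡ 1 ×
    (∃ λ m → m < n × x ≡ k ^ m × digit k m y ≢ 0 × (∀ j → m < j → j < n → digit k j y ≡ 0))

  leadingPowers⇒digits : ∀ {x y} → LeadingPowers x y → Digits x y
  leadingPowers⇒digits (a , b , r , b<a , refl , refl , magnitude-r@(_ , r<k^[1+b])) =
    a , proj₁ magnitude-y , proj₂ magnitude-y ,
    digit-k^a+r-top (<-≤-trans r<k^[1+b] (^-monoʳ-≤ k b<a)) ,
    b , b<a , refl ,
    (λ dᵦ≡0 → magnitude⇒digit≢0 {b} magnitude-r (trans (sym (digit-k^a+r r b<a)) dᵦ≡0)) ,
    λ j b<j j<a → trans (digit-k^a+r r j<a) (digit-small (<-≤-trans r<k^[1+b] (^-monoʳ-≤ k b<j)))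
    where
      magnitude-y : Magnitude a (k ^ a + r)
      magnitude-y = magnitude-+ b<a magnitude-r

  digits⇒leadingPowers : ∀ {x y} → Digits x y → LeadingPowers x y
  digits⇒leadingPowers {y = y} (n , _ , y<k^[1+n] , dₙ≡1 , m , m<n , refl , dₘ≢0 , zeros) =
    n , m , d * k ^ m + e , m<n , refl , y≡k^n+d*k^m+e ,
    magnitude-digitBlock {m} (n≢0⇒n>0 dₘ≢0) (digit<k m y) (m%n<n y (k ^ m))
    where
      open ≡-Reasoning
      open +-*-Solver
      instance _ = m^n≢0 k m
      d = digit k m y
      e = y % k ^ m
      s = n ∸ suc m
      1+m+s≡n : suc m + s ≡ n
      1+m+s≡n = m+[n∸m]≡n m<n
      y/k^[1+m]≡k^s : y /k^ suc m ≡ k ^ s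
      y/k^[1+m]≡k^s = begin
        y /k^ suc m              ≡⟨ /k^-zeroDigits y (suc m) s (λ i 1+m≤i i<1+m+s →
                                      zeros i 1+m≤i (subst (i <_) 1+m+s≡n i<1+m+s)) ⟩
        y /k^ (suc m + s) * k ^ s ≡⟨ cong (λ t → y /k^ t * k ^ s) 1+m+s≡n ⟩
        y /k^ n * k ^ s          ≡⟨ cong (_* k ^ s) (trans (sym (digit-top {n} y<k^[1+n])) dₙ≡1) ⟩
        1 * k ^ s                ≡⟨ *-identityˡ (k ^ s) ⟩
        k ^ s                    ∎
      k^[1+s]*k^m≡k^n : k ^ suc s * k ^ m ≡ k ^ n
      k^[1+s]*k^m≡k^n = trans (sym (^-distribˡ-+-* k (suc s) m))
                              (cong (k ^_) (trans (cong suc (+-comm s m)) 1+m+s≡n))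
      y≡k^n+d*k^m+e : y ≡ k ^ n + (d * k ^ m + e)
      y≡k^n+d*k^m+e = begin
        y                                  ≡⟨ m≡m%n+[m/n]*n y (k ^ m) ⟩
        e + y /k^ m * k ^ m                ≡⟨ cong (λ t → e + t * k ^ m) (/k^-digitStep m y) ⟩
        e + (y /k^ suc m * k + d) * k ^ m  ≡⟨ cong (λ t → e + (t * k + d) * k ^ m) y/k^[1+m]≡k^s ⟩
        e + (k ^ s * k + d) * k ^ m        ≡⟨ solve 5 (λ e p k d q → e :+ (p :* k :+ d) :* q := k :* p :* q :+ (d :* q :+ e))
                                                refl e (k ^ s) k d (k ^ m) ⟩
        k ^ suc s * k ^ m + (d * k ^ m + e) ≡⟨ cong (_+ (d * k ^ m + e)) k^[1+s]*k^m≡k^n ⟩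
        k ^ n + (d * k ^ m + e)            ∎

lemma3p3 : (k ℓ : ℕ) → 1 < k → 1 < ℓ → k < ℓ → MultIndep k ℓ →
    (x y : ℕ) → IsPowOf k x → IsPowOf ℓ y →
    (InS k ℓ x y ⇔ (∃ λ z → IsPowOf k z × x < z × z + x ≤ y × y < z + k * x))
    × (InS k ℓ x y ⇔ (∃ λ n → k ^ n ≤ y × y < k ^ (suc n) × digit k n y ≡ 1 ×
         (∃ λ m → m < n × x ≡ k ^ m × digit k m y ≢ 0 ×
           (∀ j → m < j → j < n → digit k j y ≡ 0))))
lemma3p3 k ℓ 1<k _ _ _ x y px py =
  mk⇔ (leadingPowers⇒window ∘ inS⇒leadingPowers) (leadingPowers⇒inS px py ∘ window⇒leadingPowers px) ,
  mk⇔ (leadingPowers⇒digits ∘ inS⇒leadingPowers) (leadingPowers⇒inS px py ∘ digits⇒leadingPowers)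
  where open Base k 1<k
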